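{- Let $m \ge 1$ and let $Z=\langle z_1, z_2, \ldots, z_{2m} \rangle$ be a Half-delete Nim position with $2m$ heaps, where $z_1 \le z_2 \le \cdots \le z_{2m}$ are positive integers. Let $2^s$ be the smallest power of $2$ strictly greater than $z_{m+1}$. Then $Z$ is a $\mathcal{P}$-position if and only if both of the following hold: (a) all of $z_1, z_2, \ldots, z_{m+1}$ are odd; (b) for every $l \in \{1,\ldots,2m\}$, if $z_l$ is even then $2^s \le z_l$.
   Context: Half-delete Nim with $n=2m$ heaps: a position is a $2m$-tuple of positive integers (heap sizes). Two players alternate moves. A move consists of selecting $m$ heaps and deleting them, and then splitting each of the remaining $m$ heaps into two heaps, each containing at least one token (so the number of heaps stays $2m$). Normal play convention: a player who cannot move loses. A $\mathcal{P}$-position is a position from which the player about to move has no winning strategy. -}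

module Defs where

open import Data.Nat using (ℕ; _+_; _≤_)
open import Data.List using (List; []; _∷_; _++_; length)
open import Data.List.Relation.Binary.Permutation.Propositional using (_↭_)
open import Data.Product using (Σ; _×_; ∃)
open import Relation.Binary.PropositionalEquality using (_≡_)
open import Relation.Nullary using (¬_)

-- A Half-delete Nim position is a list of heap sizes (of length 2m).
-- Order of heaps is irrelevant to play; positions are compared up to
-- permutation when describing moves.

data Splits : List ℕ → List ℕ → Set where
  []  : Splits [] []
  _∷_ : ∀ {x a b ks qs} → (1 ≤ a × 1 ≤ b × a + b ≡ x) → Splits ks qs →
        Splits (x ∷ ks) (a ∷ b ∷ qs)

record Move (m : ℕ) (P Q : List ℕ) : Set where
  field
    kept deleted : List ℕ
    kept-len     : length kept ≡ m
    deleted-len  : length deleted ≡ m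
    partition    : P ↭ kept ++ deleted
    split        : List ℕ
    splits       : Splits kept split
    result       : Q ↭ split

-- Win m P : the player about to move from P has a winning strategy
-- (normal play: a player who cannot move loses).
data Win (m : ℕ) (P : List ℕ) : Set
data Lose (m : ℕ) (P : List ℕ) : Set

data Win m P where
  win : ∀ {Q} → Move m P Q → Lose m Q → Win m P

data Lose m P where
  lose : (∀ Q → Move m P Q → Win m Q) → Lose m P

IsPPosition : ℕ → List ℕ → Set
IsPPosition m P = ¬ Win m P

-- Call a position P-shaped if, for some power of two T, every heap below T is odd and more
-- than m heaps are below T.  No move joins two P-shaped positions: as only m heaps are
-- deleted, some kept heap is below T, hence odd, so one of its pieces is even, which forces
-- the new threshold T′ below T; and since more than m of the 2m pieces lie below T′, some
-- kept heap has both pieces below T′, so it is even and smaller than 2T′ ≤ T.  Any other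
-- position has an even heap e with 2^t ≤ e < 2^(t+1) and at most m heaps below T = 2^t;
-- splitting e into the odd pieces T - 1 and e - T + 1, chipping one token off m - 1
-- further heaps of size at least T and deleting the rest gives a P-shaped position.  As
-- moves decrease the number of tokens, the P-shaped positions are exactly the P-positions;
-- for a sorted position, being P-shaped is being P-shaped for the least power of two above
-- z_{m+1}, which is conditions (a) and (b).
module Submission where

open import Defs
open import Data.Nat using (ℕ; suc; _+_; _≤_; _<_; _^_)
open import Data.Nat.Divisibility using (_∣_)
open import Data.Fin using (Fin; toℕ; _↑ʳ_; zero) renaming (_≤_ to _≤ᶠ_)
open import Data.Vec using (Vec; lookup; toList)
open import Data.Product using (_×_)
open import Function.Bundles using (_⇔_)
open import Relation.Nullary using (¬_)

open import Data.Nat using (zero; _*_; _∸_; z≤n; s≤s; z<s)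
open import Data.Nat.Properties
open import Data.Nat.Divisibility using (_∤_; _∣?_; divides; >⇒∤; ∣m+n∣m⇒∣n; ∣m∣n⇒∣m+n; m∣m*n)
open import Data.Nat.Induction using (<-wellFounded)
open import Data.Nat.ListAction using (sum)
open import Data.Nat.ListAction.Properties using (sum-++; sum-↭)
import Data.Fin as Fin
open import Data.Fin.Properties using (toℕ-↑ʳ)
open import Data.Vec using (_∷_)
open import Data.Vec.Properties using (length-toList)
open import Data.Vec.Membership.Propositional.Properties using (∈-lookup; ∈-toList⁺)
open import Data.Vec.Relation.Unary.All.Properties using (lookup⁻; toList⁺)
open import Data.List using (List; []; _∷_; _++_; length; filter; take; drop)
open import Data.List.Properties using (length-++; length-filter; filter-all; filter-none; filter-accept; filter-reject; filter-++; length-take; take++drop≡id; ++-assoc)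
open import Data.List.Relation.Unary.All as All using (All; []; _∷_)
open import Data.List.Relation.Unary.All.Properties using (++⁻ʳ; all-filter; take⁺)
open import Data.List.Relation.Unary.Any using (here; there)
open import Data.List.Membership.Propositional using (_∈_)
open import Data.List.Membership.Propositional.Properties using (∈-∃++; ∈-++⁺ˡ)
open import Data.List.Relation.Binary.Permutation.Propositional using (_↭_; prep; ↭-refl; ↭-sym; ↭-trans)
open import Data.List.Relation.Binary.Permutation.Propositional.Properties using (All-resp-↭; ∈-resp-↭; ↭-length; shift; filter-↭; ++-comm)
open import Data.Product using (∃-syntax; _,_; proj₁; proj₂; map₁; map₂)
open import Data.Sum using (_⊎_; inj₁; inj₂; [_,_]′)
open import Induction.WellFounded using (Acc; acc)
open import Relation.Nullary using (yes; no; contradiction; _×-dec_)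
open import Relation.Unary using (Decidable)
open import Relation.Unary.Properties using (∁?)
open import Relation.Binary.PropositionalEquality using (_≡_; refl; sym; trans; cong; cong₂; subst; subst₂; module ≡-Reasoning)
open import Function.Bundles using (mk⇔)

private
  variable
    k m n T x e : ℕ
    xs ks qs L P Q : List ℕ

2∤1 : 2 ∤ 1
2∤1 = >⇒∤ (s≤s (s≤s z≤n))

2∣⊎2∣suc : ∀ n → 2 ∣ n ⊎ 2 ∣ suc n
2∣⊎2∣suc zero = inj₁ (divides 0 refl)
2∣⊎2∣suc (suc n) with 2∣⊎2∣suc n
... | inj₁ (divides q n≡q*2) = inj₂ (divides (suc q) (cong (λ y → suc (suc y)) n≡q*2))
... | inj₂ 2∣1+n = inj₁ 2∣1+n

2∣⇒2∤suc : 2 ∣ n → 2 ∤ suc n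
2∣⇒2∤suc {n} 2∣n 2∣1+n = 2∤1 (∣m+n∣m⇒∣n (subst (2 ∣_) (+-comm 1 n) 2∣1+n) 2∣n)

2∤+2∤⇒2∣ : ∀ {a b} → 2 ∤ a → 2 ∤ b → 2 ∣ a + b
2∤+2∤⇒2∣ {a} {b} 2∤a 2∤b with 2∣⊎2∣suc a | 2∣⊎2∣suc b
... | inj₁ 2∣a | _ = contradiction 2∣a 2∤a
... | _ | inj₁ 2∣b = contradiction 2∣b 2∤b
... | inj₂ 2∣1+a | inj₂ 2∣1+b = ∣m+n∣m⇒∣n 2∣2+a+b (divides 1 refl)
  where
  2∣2+a+b : 2 ∣ 2 + (a + b)
  2∣2+a+b = subst (2 ∣_) (cong suc (+-suc a b)) (∣m∣n⇒∣m+n 2∣1+a 2∣1+b)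

least-even : ∀ xs → (∃[ e ] e ∈ xs × 2 ∣ e × All (λ y → 2 ∣ y → e ≤ y) xs) ⊎ All (2 ∤_) xs
least-even [] = inj₂ []
least-even (x ∷ xs) with least-even xs | 2 ∣? x
... | inj₂ odd | no 2∤x = inj₂ (2∤x ∷ odd)
... | inj₂ odd | yes 2∣x =
  inj₁ (x , here refl , 2∣x , (λ _ → ≤-refl) ∷ All.map (λ 2∤y 2∣y → contradiction 2∣y 2∤y) odd)
... | inj₁ (e , e∈xs , 2∣e , least) | no 2∤x =
  inj₁ (e , there e∈xs , 2∣e , (λ 2∣x → contradiction 2∣x 2∤x) ∷ least)
... | inj₁ (e , e∈xs , 2∣e , least) | yes 2∣x with x ≤? e
...   | yes x≤e =
  inj₁ (x , here refl , 2∣x , (λ _ → ≤-refl) ∷ All.map (λ e≤y 2∣y → ≤-trans x≤e (e≤y 2∣y)) least)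
...   | no x≰e = inj₁ (e , there e∈xs , 2∣e , (λ _ → <⇒≤ (≰⇒> x≰e)) ∷ least)

2^-bracket : 1 ≤ n → ∃[ t ] 2 ^ t ≤ n × n < 2 ^ suc t
2^-bracket {suc zero} _ = 0 , s≤s z≤n , s≤s (s≤s z≤n)
2^-bracket {suc (suc n)} _ with 2^-bracket {suc n} (s≤s z≤n)
... | t , lo , hi with m≤n⇒m<n∨m≡n hi
...   | inj₁ 2+n<2^[1+t] = t , m≤n⇒m≤1+n lo , 2+n<2^[1+t]
...   | inj₂ 2+n≡2^[1+t] =
  suc t , ≤-reflexive (sym 2+n≡2^[1+t]) ,
    subst (_< 2 ^ suc (suc t)) (sym 2+n≡2^[1+t]) (^-monoʳ-< 2 (s≤s (s≤s z≤n)) {suc t} ≤-refl)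

2^a<2^b⇒2^[1+a]≤2^b : ∀ {a b} → 2 ^ a < 2 ^ b → 2 * 2 ^ a ≤ 2 ^ b
2^a<2^b⇒2^[1+a]≤2^b {a} {b} 2^a<2^b =
  ^-monoʳ-≤ 2 {suc a} {b} (≰⇒> λ b≤a → <⇒≱ 2^a<2^b (^-monoʳ-≤ 2 b≤a))

∈⇒≤sum : x ∈ xs → x ≤ sum xs
∈⇒≤sum {xs = _ ∷ xs} (here refl) = m≤m+n _ (sum xs)
∈⇒≤sum {xs = y ∷ _} (there x∈xs) = ≤-trans (∈⇒≤sum x∈xs) (m≤n+m _ y)

all-below-some-2^ : ∀ xs → ∃[ t ] All (_< 2 ^ t) xs
all-below-some-2^ xs with t , _ , sum<2^[1+t] ← 2^-bracket {suc (sum xs)} (s≤s z≤n) =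
  suc t , All.tabulate λ x∈xs → <-trans (s≤s (∈⇒≤sum x∈xs)) sum<2^[1+t]

∈⇒↭∷ : x ∈ xs → ∃[ ys ] xs ↭ x ∷ ys
∈⇒↭∷ {x} x∈xs with ys , zs , refl ← ∈-∃++ x∈xs = ys ++ zs , shift x ys zs

filter-∁-↭ : ∀ {P : ℕ → Set} (P? : Decidable P) xs → xs ↭ filter P? xs ++ filter (∁? P?) xs
filter-∁-↭ P? [] = ↭-refl
filter-∁-↭ P? (x ∷ xs) with P? x
... | yes _ = prep x (filter-∁-↭ P? xs)
... | no _ = ↭-trans (prep x (filter-∁-↭ P? xs)) (↭-sym (shift x (filter P? xs) _))

countBelow : ℕ → List ℕ → ℕ
countBelow T xs = length (filter (_<? T) xs)

countBelow-↭ : ∀ T → xs ↭ qs → countBelow T xs ≡ countBelow T qs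
countBelow-↭ T xs↭qs = ↭-length (filter-↭ (_<? T) xs↭qs)

countBelow-++ : ∀ T xs qs → countBelow T (xs ++ qs) ≡ countBelow T xs + countBelow T qs
countBelow-++ T xs qs = trans (cong length (filter-++ (_<? T) xs qs)) (length-++ (filter (_<? T) xs))

countBelow-accept : x < T → countBelow T (x ∷ xs) ≡ suc (countBelow T xs)
countBelow-accept {T = T} x<T = cong length (filter-accept (_<? T) x<T)

countBelow-reject : ¬ x < T → countBelow T (x ∷ xs) ≡ countBelow T xs
countBelow-reject {T = T} x≮T = cong length (filter-reject (_<? T) x≮T)

countBelow-∷-≤ : ∀ T x xs → countBelow T (x ∷ xs) ≤ suc (countBelow T xs)
countBelow-∷-≤ T x xs with x <? T
... | yes x<T = ≤-reflexive (countBelow-accept x<T)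
... | no x≮T = ≤-trans (≤-reflexive (countBelow-reject x≮T)) (n≤1+n _)

countBelow-∷-≥ : ∀ T x xs → countBelow T xs ≤ countBelow T (x ∷ xs)
countBelow-∷-≥ T x xs with x <? T
... | yes x<T = ≤-trans (n≤1+n _) (≤-reflexive (sym (countBelow-accept x<T)))
... | no x≮T = ≤-reflexive (sym (countBelow-reject x≮T))

countBelow-pair-≤ : ∀ {a b} → ¬ (a < T × b < T) → countBelow T (a ∷ b ∷ qs) ≤ suc (countBelow T qs)
countBelow-pair-≤ {T} {qs} {a} {b} ¬both with a <? T | b <? T
... | yes a<T | yes b<T = contradiction (a<T , b<T) ¬both
... | no a≮T | _ = ≤-trans (≤-reflexive (countBelow-reject a≮T)) (countBelow-∷-≤ T b qs)
... | yes _ | no b≮T =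
  ≤-trans (countBelow-∷-≤ T a (b ∷ qs)) (s≤s (≤-reflexive (countBelow-reject b≮T)))

countBelow-all : All (_< T) xs → countBelow T xs ≡ length xs
countBelow-all {T} all-below = cong length (filter-all (_<? T) all-below)

countBelow-pos : 0 < countBelow T xs → ∃[ x ] x ∈ xs × x < T
countBelow-pos {T} {x ∷ xs} 0<count with x <? T
... | yes x<T = x , here refl , x<T
... | no x≮T with y , y∈xs , y<T ← countBelow-pos (subst (0 <_) (countBelow-reject x≮T) 0<count) =
  y , there y∈xs , y<T

OddBelow : ℕ → List ℕ → Set
OddBelow T = All (λ x → x < T → 2 ∤ x)

oddBelow-even⇒≥ : OddBelow T xs → x ∈ xs → 2 ∣ x → T ≤ x
oddBelow-even⇒≥ odd x∈xs 2∣x = ≮⇒≥ λ x<T → All.lookup odd x∈xs x<T 2∣x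

splits-sum : Splits ks qs → sum qs ≡ sum ks
splits-sum [] = refl
splits-sum {qs = a ∷ b ∷ qs} ((_ , _ , a+b≡x) ∷ s) =
  trans (sym (+-assoc a b (sum qs))) (cong₂ _+_ a+b≡x (splits-sum s))

splits-length : Splits ks qs → length qs ≡ length ks + length ks
splits-length [] = refl
splits-length {ks = _ ∷ ks} (_ ∷ s) =
  cong suc (trans (cong suc (splits-length s)) (sym (+-suc (length ks) (length ks))))

splits-positive : Splits ks qs → All (1 ≤_) qs
splits-positive [] = []
splits-positive ((1≤a , 1≤b , _) ∷ s) = 1≤a ∷ 1≤b ∷ splits-positive s

splits-odd⇒even-piece : Splits ks qs → x ∈ ks → 2 ∤ x → ∃[ e ] e ∈ qs × 2 ∣ e × e < x
splits-odd⇒even-piece {qs = a ∷ b ∷ _} ((1≤a , 1≤b , a+b≡x) ∷ _) (here refl) 2∤x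
  with 2 ∣? a | 2 ∣? b
... | yes 2∣a | _ = a , here refl , 2∣a , subst (a <_) a+b≡x (m<m+n a 1≤b)
... | no _ | yes 2∣b = b , there (here refl) , 2∣b , subst (b <_) a+b≡x (m<n+m b 1≤a)
... | no 2∤a | no 2∤b = contradiction (subst (2 ∣_) a+b≡x (2∤+2∤⇒2∣ 2∤a 2∤b)) 2∤x
splits-odd⇒even-piece (_ ∷ s) (there x∈ks) 2∤x
  with e , e∈qs , 2∣e , e<x ← splits-odd⇒even-piece s x∈ks 2∤x = e , there (there e∈qs) , 2∣e , e<x

splits-pigeonhole : Splits ks qs → OddBelow T qs → length ks < countBelow T qs →
                    ∃[ x ] x ∈ ks × 2 ∣ x × x < 2 * T
splits-pigeonhole {qs = a ∷ b ∷ qs} {T = T} ((_ , _ , a+b≡x) ∷ s) (odd-a ∷ odd-b ∷ odd) many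
  with a <? T ×-dec b <? T
... | yes (a<T , b<T) =
  _ , here refl , subst (2 ∣_) a+b≡x (2∤+2∤⇒2∣ (odd-a a<T) (odd-b b<T)) ,
  subst (_< 2 * T) a+b≡x (subst (a + b <_) (cong (T +_) (sym (+-identityʳ T))) (+-mono-< a<T b<T))
... | no ¬both =
  map₂ (map₁ there) (splits-pigeonhole s odd (≤-pred (≤-trans many (countBelow-pair-≤ ¬both))))

split-even-heap : 2 ∣ T → 2 ∣ e → T ≤ e → e < 2 * T →
  ∃[ a ] ∃[ b ] (1 ≤ a × 1 ≤ b × a + b ≡ e) × (a < T × 2 ∤ a) × (b < T × 2 ∤ b)
split-even-heap {suc zero} 2∣1 _ _ _ = contradiction 2∣1 2∤1
split-even-heap {T@(suc u@(suc _))} {e} 2∣T 2∣e T≤e e<2T =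
  u , e ∸ u , (s≤s z≤n , m<n⇒0<n∸m T≤e , u+b≡e) , (≤-refl , 2∤u) , (b<T , 2∤b)
  where
  u+b≡e : u + (e ∸ u) ≡ e
  u+b≡e = m+[n∸m]≡n (≤-trans (n≤1+n u) T≤e)
  2∤u : 2 ∤ u
  2∤u 2∣u = 2∣⇒2∤suc 2∣u 2∣T
  2∤b : 2 ∤ e ∸ u
  2∤b 2∣b = 2∤u (∣m+n∣m⇒∣n (subst (2 ∣_) (sym (trans (+-comm (e ∸ u) u) u+b≡e)) 2∣e) 2∣b)
  b≤T : e ∸ u ≤ T
  b≤T = begin
    e ∸ u       ≤⟨ ∸-monoˡ-≤ u (≤-pred (subst (e <_) (cong (T +_) (+-identityʳ T)) e<2T)) ⟩
    u + T ∸ u   ≡⟨ m+n∸m≡n u T ⟩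
    T           ∎
    where open ≤-Reasoning
  b<T : e ∸ u < T
  b<T = ≤∧≢⇒< b≤T λ b≡T → 2∤b (subst (2 ∣_) (sym b≡T) 2∣T)

chip : List ℕ → List ℕ
chip [] = []
chip (x ∷ xs) = 1 ∷ x ∸ 1 ∷ chip xs

chip-splits : All (2 ≤_) xs → Splits xs (chip xs)
chip-splits [] = []
chip-splits (s≤s (s≤s _) ∷ big) = (s≤s z≤n , s≤s z≤n , refl) ∷ chip-splits big

chipped-below-odd : 2 ∣ T → T ≤ x → x ∸ 1 < T → 2 ∤ x ∸ 1
chipped-below-odd {x = zero} _ T≤0 0<T = contradiction T≤0 (<⇒≱ 0<T)
chipped-below-odd {x = suc x} 2∣T T≤1+x 1+x≤T 2∣x =
  2∣⇒2∤suc 2∣x (subst (2 ∣_) (≤-antisym T≤1+x 1+x≤T) 2∣T)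

chip-oddBelow : 2 ∣ T → All (T ≤_) xs → OddBelow T (chip xs)
chip-oddBelow 2∣T [] = []
chip-oddBelow 2∣T (T≤x ∷ big) = (λ _ → 2∤1) ∷ chipped-below-odd 2∣T T≤x ∷ chip-oddBelow 2∣T big

chip-countBelow : 1 < T → ∀ xs → length xs ≤ countBelow T (chip xs)
chip-countBelow 1<T [] = z≤n
chip-countBelow {T} 1<T (x ∷ xs) = begin
  suc (length xs)                       ≤⟨ s≤s (chip-countBelow 1<T xs) ⟩
  suc (countBelow T (chip xs))          ≤⟨ s≤s (countBelow-∷-≥ T (x ∸ 1) (chip xs)) ⟩
  suc (countBelow T (x ∸ 1 ∷ chip xs))  ≡⟨ countBelow-accept 1<T ⟨
  countBelow T (chip (x ∷ xs))          ∎
  where open ≤-Reasoning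

IsPosition : ℕ → List ℕ → Set
IsPosition m L = All (1 ≤_) L × length L ≡ m + m

move-isPosition : Move m P Q → IsPosition m Q
move-isPosition mv =
  All-resp-↭ (↭-sym result) (splits-positive splits) ,
  trans (↭-length result) (trans (splits-length splits) (cong₂ _+_ kept-len kept-len))
  where open Move mv

move-kept⊆ : (mv : Move m P Q) → x ∈ Move.kept mv → x ∈ P
move-kept⊆ mv x∈kept = ∈-resp-↭ (↭-sym partition) (∈-++⁺ˡ x∈kept)
  where open Move mv

move-decreases-sum : All (1 ≤_) P → Move (suc k) P Q → sum Q < sum P
move-decreases-sum {P = P} {Q = Q} positive mv = begin-strict
  sum Q                     ≡⟨ sum-↭ result ⟩
  sum split                 ≡⟨ splits-sum splits ⟩
  sum kept                  <⟨ m<m+n (sum kept) 0<sum-deleted ⟩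
  sum kept + sum deleted    ≡⟨ sum-++ kept deleted ⟨
  sum (kept ++ deleted)     ≡⟨ sum-↭ partition ⟨
  sum P                     ∎
  where
  open Move mv
  open ≤-Reasoning
  0<sum-deleted : 0 < sum deleted
  0<sum-deleted with deleted | ++⁻ʳ kept (All-resp-↭ partition positive) | deleted-len
  ... | d ∷ _ | 1≤d ∷ _ | _ = ≤-trans 1≤d (m≤m+n d _)

kept-below : (mv : Move m P Q) → m < countBelow T P → ∃[ x ] x ∈ Move.kept mv × x < T
kept-below {m} {P} {T = T} mv many = countBelow-pos (+-cancelʳ-< m 0 (countBelow T kept) (begin-strict
  m                                          <⟨ many ⟩
  countBelow T P                             ≡⟨ countBelow-↭ T partition ⟩
  countBelow T (kept ++ deleted)             ≡⟨ countBelow-++ T kept deleted ⟩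
  countBelow T kept + countBelow T deleted   ≤⟨ +-monoʳ-≤ (countBelow T kept) deleted-few ⟩
  countBelow T kept + m                      ∎))
  where
  open Move mv
  open ≤-Reasoning
  deleted-few : countBelow T deleted ≤ m
  deleted-few = subst (countBelow T deleted ≤_) deleted-len (length-filter (_<? T) deleted)

next-threshold-< : ∀ {S S′} → OddBelow S P → m < countBelow S P →
                   (mv : Move m P Q) → OddBelow S′ Q → S′ < S
next-threshold-< odd-P many mv odd-Q
  with x , x∈kept , x<S ← kept-below mv many
  with e , e∈split , 2∣e , e<x ← splits-odd⇒even-piece (Move.splits mv) x∈kept
                                    (All.lookup odd-P (move-kept⊆ mv x∈kept) x<S)
  = ≤-<-trans (oddBelow-even⇒≥ (All-resp-↭ (Move.result mv) odd-Q) e∈split 2∣e) (<-trans e<x x<S)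

next-threshold->half : ∀ {S S′} → OddBelow S P → (mv : Move m P Q) →
                       OddBelow S′ Q → m < countBelow S′ Q → S < 2 * S′
next-threshold->half {S′ = S′} odd-P mv odd-Q many
  with y , y∈kept , 2∣y , y<2S′ ← splits-pigeonhole (Move.splits mv) (All-resp-↭ (Move.result mv) odd-Q)
                                    (subst₂ _<_ (sym (Move.kept-len mv)) (countBelow-↭ S′ (Move.result mv)) many)
  = ≤-<-trans (oddBelow-even⇒≥ odd-P (move-kept⊆ mv y∈kept) 2∣y) y<2S′

pick-large-heaps : e ∈ L → T ≤ e → length L ≡ suc (k + n) → countBelow T L ≤ n →
  ∃[ as ] ∃[ ds ] L ↭ (e ∷ as) ++ ds × length as ≡ k × length ds ≡ n × All (T ≤_) as
pick-large-heaps {e} {L} {T} {k} {n} e∈L T≤e len few with L′ , L↭e∷L′ ← ∈⇒↭∷ e∈L =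
  as , ds , L↭ , length-as , length-ds , All.map ≮⇒≥ (take⁺ k (all-filter (∁? (_<? T)) L′))
  where
  small = filter (_<? T) L′
  big = filter (∁? (_<? T)) L′
  as = take k big
  ds = drop k big ++ small
  L↭ : L ↭ (e ∷ as) ++ ds
  L↭ = ↭-trans L↭e∷L′ (prep e (subst (L′ ↭_) big++small≡
                                  (↭-trans (filter-∁-↭ (_<? T) L′) (++-comm small big))))
    where
    big++small≡ : big ++ small ≡ as ++ ds
    big++small≡ = trans (cong (_++ small) (sym (take++drop≡id k big))) (++-assoc as (drop k big) small)
  few-small : length small ≤ n
  few-small = ≤-trans (countBelow-∷-≥ T e L′) (subst (_≤ n) (countBelow-↭ T L↭e∷L′) few)
  length-L′ : length big + length small ≡ k + n
  length-L′ = begin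
    length big + length small  ≡⟨ length-++ big ⟨
    length (big ++ small)      ≡⟨ ↭-length (++-comm big small) ⟩
    length (small ++ big)      ≡⟨ ↭-length (filter-∁-↭ (_<? T) L′) ⟨
    length L′                  ≡⟨ suc-injective (trans (↭-length (↭-sym L↭e∷L′)) len) ⟩
    k + n                      ∎
    where open ≡-Reasoning
  length-as : length as ≡ k
  length-as = trans (length-take k big)
    (m≤n⇒m⊓n≡m (+-cancelʳ-≤ n k (length big)
      (subst (_≤ length big + n) length-L′ (+-monoʳ-≤ (length big) few-small))))
  length-ds : length ds ≡ n
  length-ds = +-cancelˡ-≡ k _ _ (begin
    k + length ds              ≡⟨ cong (_+ length ds) length-as ⟨
    length as + length ds      ≡⟨ length-++ as ⟨
    length (as ++ ds)          ≡⟨ suc-injective (trans (↭-length (↭-sym L↭)) len) ⟩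
    k + n                      ∎)
    where open ≡-Reasoning

Lose⇒¬Win : Lose m P → ¬ Win m P
Lose⇒¬Win (lose every-move-wins) (win mv lost) = Lose⇒¬Win lost (every-move-wins _ mv)

module _ {m : ℕ} {Inv G N : List ℕ → Set}
         (Inv-move : ∀ {P Q} → Inv P → Move m P Q → Inv Q)
         (sum-move : ∀ {P Q} → Inv P → Move m P Q → sum Q < sum P)
         (G⊎N : ∀ {P} → Inv P → G P ⊎ N P)
         (G-move-¬G : ∀ {P Q} → G P → Move m P Q → ¬ G Q)
         (N-move-G : ∀ {P} → Inv P → N P → ∃[ Q ] Move m P Q × G Q)
         where

  outcome : Acc _<_ (sum P) → Inv P → (G P → Lose m P) × (N P → Win m P)
  outcome {P} (acc smaller) inv = G⇒Lose , N⇒Win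
    where
    after : Move m P Q → (G Q → Lose m Q) × (N Q → Win m Q)
    after mv = outcome (smaller (sum-move inv mv)) (Inv-move inv mv)

    G⇒Lose : G P → Lose m P
    G⇒Lose g = lose λ Q mv →
      [ (λ g′ → contradiction g′ (G-move-¬G g mv)) , proj₂ (after mv) ]′ (G⊎N (Inv-move inv mv))

    N⇒Win : N P → Win m P
    N⇒Win n with Q , mv , g ← N-move-G inv n = win mv (proj₁ (after mv) g)

PShape : ℕ → List ℕ → Set
PShape m L = ∃[ t ] OddBelow (2 ^ t) L × m < countBelow (2 ^ t) L

NShape : ℕ → List ℕ → Set
NShape m L = ∃[ e ] e ∈ L × 2 ∣ e × ∃[ t ] 2 ^ t ≤ e × e < 2 ^ suc t × countBelow (2 ^ t) L ≤ m

pShape-move-¬pShape : PShape m P → Move m P Q → ¬ PShape m Q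
pShape-move-¬pShape (s , odd-P , many-P) mv (s′ , odd-Q , many-Q) =
  <⇒≱ (next-threshold->half odd-P mv odd-Q many-Q)
      (2^a<2^b⇒2^[1+a]≤2^b {s′} {s} (next-threshold-< odd-P many-P mv odd-Q))

pShape⊎nShape : All (1 ≤_) L → m < length L → PShape m L ⊎ NShape m L
pShape⊎nShape {L} {m} positive long with least-even L
... | inj₂ all-odd with t , all-below ← all-below-some-2^ L =
  inj₁ (t , All.map (λ 2∤x _ → 2∤x) all-odd , subst (_ <_) (sym (countBelow-all all-below)) long)
... | inj₁ (e , e∈L , 2∣e , least) with t , 2^t≤e , e<2^[1+t] ← 2^-bracket (All.lookup positive e∈L)
  with countBelow (2 ^ t) L ≤? m
...   | yes few = inj₂ (e , e∈L , 2∣e , t , 2^t≤e , e<2^[1+t] , few)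
...   | no ¬few =
  inj₁ (t , All.map (λ e≤y y<2^t 2∣y → <⇒≱ (<-≤-trans y<2^t 2^t≤e) (e≤y 2∣y)) least , ≰⇒> ¬few)

nShape⇒move-to-pShape : length L ≡ suc k + suc k → NShape (suc k) L →
                        ∃[ Q ] Move (suc k) L Q × PShape (suc k) Q
nShape⇒move-to-pShape _ (e , _ , 2∣e , zero , 1≤e , e<2 , _) =
  contradiction (subst (2 ∣_) (≤-antisym (≤-pred e<2) 1≤e) 2∣e) 2∤1
nShape⇒move-to-pShape {L} {k} len (e , e∈L , 2∣e , suc t , T≤e , e<2T , few)
  with as , ds , L↭ , length-as , length-ds , big ← pick-large-heaps e∈L T≤e len few
     | a , b , a+b≡e , (a<T , 2∤a) , (b<T , 2∤b) ← split-even-heap (m∣m*n (2 ^ t)) 2∣e T≤e e<2T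
  = a ∷ b ∷ chip as , move , suc t , odd , many
  where
  S = 2 ^ suc t
  2≤S : 2 ≤ S
  2≤S = *-monoʳ-≤ 2 (m^n>0 2 t)
  move : Move (suc k) L (a ∷ b ∷ chip as)
  move = record
    { kept = e ∷ as ; deleted = ds ; kept-len = cong suc length-as ; deleted-len = length-ds
    ; partition = L↭ ; split = a ∷ b ∷ chip as
    ; splits = a+b≡e ∷ chip-splits (All.map (≤-trans 2≤S) big) ; result = ↭-refl }
  odd : OddBelow S (a ∷ b ∷ chip as)
  odd = (λ _ → 2∤a) ∷ (λ _ → 2∤b) ∷ chip-oddBelow (m∣m*n (2 ^ t)) big
  many : suc k < countBelow S (a ∷ b ∷ chip as)
  many = begin
    suc (suc k)                         ≡⟨ cong (λ l → suc (suc l)) length-as ⟨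
    suc (suc (length as))               ≤⟨ s≤s (s≤s (chip-countBelow 2≤S as)) ⟩
    suc (suc (countBelow S (chip as)))  ≡⟨ cong suc (countBelow-accept b<T) ⟨
    suc (countBelow S (b ∷ chip as))    ≡⟨ countBelow-accept a<T ⟨
    countBelow S (a ∷ b ∷ chip as)      ∎
    where open ≤-Reasoning

pShape⇒Lose×nShape⇒Win : IsPosition (suc k) L →
                         (PShape (suc k) L → Lose (suc k) L) × (NShape (suc k) L → Win (suc k) L)
pShape⇒Lose×nShape⇒Win {k} {L} =
  outcome (λ _ → move-isPosition)
          (λ (positive , _) → move-decreases-sum positive)
          (λ (positive , len) → pShape⊎nShape positive (subst (suc k <_) (sym len) (m<m+n (suc k) z<s)))
          pShape-move-¬pShape
          (λ (_ , len) → nShape⇒move-to-pShape len)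
          (<-wellFounded (sum L))

Sorted : Vec ℕ n → Set
Sorted z = ∀ i j → i ≤ᶠ j → lookup z i ≤ lookup z j

countBelow-≥-prefix : (z : Vec ℕ n) (j : Fin n) → (∀ i → i ≤ᶠ j → lookup z i < T) →
                      suc (toℕ j) ≤ countBelow T (toList z)
countBelow-≥-prefix (x ∷ z) j below =
  ≤-trans (s≤s (earlier j below)) (≤-reflexive (sym (countBelow-accept (below zero z≤n))))
  where
  earlier : ∀ j → (∀ i → i ≤ᶠ j → lookup (x ∷ z) i < _) → toℕ j ≤ countBelow _ (toList z)
  earlier zero _ = z≤n
  earlier (Fin.suc j) below = countBelow-≥-prefix z j (λ i i≤j → below (Fin.suc i) (s≤s i≤j))

countBelow-≤-suffix : (z : Vec ℕ n) (j : Fin n) → (∀ i → j ≤ᶠ i → T ≤ lookup z i) →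
                      countBelow T (toList z) ≤ toℕ j
countBelow-≤-suffix {T = T} z zero above =
  ≤-reflexive (cong length (filter-none (_<? T) (toList⁺ (lookup⁻ {xs = z} λ i → ≤⇒≯ (above i z≤n)))))
countBelow-≤-suffix {T = T} (x ∷ z) (Fin.suc j) above =
  ≤-trans (countBelow-∷-≤ T x (toList z))
          (s≤s (countBelow-≤-suffix z j λ i j≤i → above (Fin.suc i) (s≤s j≤i)))

sorted-countBelow-> : ∀ {z : Vec ℕ n} {j} → Sorted z → lookup z j < T → toℕ j < countBelow T (toList z)
sorted-countBelow-> {z = z} {j} sorted zⱼ<T =
  countBelow-≥-prefix z j λ i i≤j → ≤-<-trans (sorted i j i≤j) zⱼ<T

sorted-countBelow-≤ : ∀ {z : Vec ℕ n} {j} → Sorted z → T ≤ lookup z j → countBelow T (toList z) ≤ toℕ j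
sorted-countBelow-≤ {z = z} {j} sorted T≤zⱼ =
  countBelow-≤-suffix z j λ i j≤i → ≤-trans T≤zⱼ (sorted j i j≤i)

sorted-even⇒nShape : ∀ {z : Vec ℕ n} {i j} → Sorted z → 1 ≤ lookup z i → 2 ∣ lookup z i →
                     (∀ t → 2 ^ t ≤ lookup z i → 2 ^ t ≤ lookup z j) → NShape (toℕ j) (toList z)
sorted-even⇒nShape {z = z} {i} sorted 1≤zᵢ 2∣zᵢ powers-below-zⱼ
  with t , 2^t≤zᵢ , zᵢ<2^[1+t] ← 2^-bracket 1≤zᵢ =
  lookup z i , ∈-toList⁺ (∈-lookup i z) , 2∣zᵢ , t , 2^t≤zᵢ , zᵢ<2^[1+t] ,
  sorted-countBelow-≤ {z = z} sorted (powers-below-zⱼ t 2^t≤zᵢ)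

theorem5p2 : (k : ℕ) → (z : Vec ℕ (suc k + suc k)) →
    (∀ i → 1 ≤ lookup z i) →
    (∀ i j → i ≤ᶠ j → lookup z i ≤ lookup z j) →
    (s : ℕ) → lookup z (suc k ↑ʳ zero) < 2 ^ s →
    (∀ t → lookup z (suc k ↑ʳ zero) < 2 ^ t → s ≤ t) →
    IsPPosition (suc k) (toList z) ⇔
      ((∀ i → toℕ i ≤ suc k → ¬ (2 ∣ lookup z i)) ×
       (∀ i → 2 ∣ lookup z i → 2 ^ s ≤ lookup z i))
theorem5p2 k z positive sorted s zₘ<2^s s-least = mk⇔
  (λ ¬win →
    (λ i i≤1+k 2∣zᵢ → ¬win (even-below-2^s⇒Win i 2∣zᵢ
                             (≤-<-trans (sorted i M (subst (toℕ i ≤_) (sym toℕ-M) i≤1+k)) zₘ<2^s))) ,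
    (λ i 2∣zᵢ → ≮⇒≥ λ zᵢ<2^s → ¬win (even-below-2^s⇒Win i 2∣zᵢ zᵢ<2^s)))
  (λ (_ , evens-large) → Lose⇒¬Win (proj₁ status
    (s , toList⁺ (lookup⁻ λ i zᵢ<2^s 2∣zᵢ → <⇒≱ zᵢ<2^s (evens-large i 2∣zᵢ)) ,
     subst (_< countBelow (2 ^ s) (toList z)) toℕ-M (sorted-countBelow-> {z = z} sorted zₘ<2^s))))
  where
  M = suc k ↑ʳ zero
  toℕ-M : toℕ M ≡ suc k
  toℕ-M = trans (toℕ-↑ʳ (suc k) zero) (+-identityʳ (suc k))

  status : (PShape (suc k) (toList z) → Lose (suc k) (toList z)) ×
           (NShape (suc k) (toList z) → Win (suc k) (toList z))
  status = pShape⇒Lose×nShape⇒Win (toList⁺ (lookup⁻ positive) , length-toList z)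

  even-below-2^s⇒Win : ∀ i → 2 ∣ lookup z i → lookup z i < 2 ^ s → Win (suc k) (toList z)
  even-below-2^s⇒Win i 2∣zᵢ zᵢ<2^s = proj₂ status (subst (λ m → NShape m (toList z)) toℕ-M
    (sorted-even⇒nShape {z = z} sorted (positive i) 2∣zᵢ λ t 2^t≤zᵢ →
      ≮⇒≥ λ zₘ<2^t → <⇒≱ zᵢ<2^s (≤-trans (^-monoʳ-≤ 2 (s-least t zₘ<2^t)) 2^t≤zᵢ)))
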